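{- Let $A\in\mathbb{Z}^{m\times d}$ with $\ker_{\mathbb{Z}}(A)\cap\mathbb{N}^d=\{0\}$ and let $\mathcal{M}\subset\ker_{\mathbb{Z}}(A)$ be a Markov basis of $\mathcal{P}_A$. Then $\mathcal{M}$ is norm-like for $\mathcal{P}_A$.
   Context: $\mathbb{N}=\{0,1,2,\dots\}$. For $b\in\mathbb{Z}^m$, $\mathcal{F}_{A,b}:=\{u\in\mathbb{N}^d:Au=b\}$ and $\mathcal{P}_A:=\{\mathcal{F}_{A,b}:b\in\mathbb{N}A\}$, $\mathbb{N}A$ the semigroup generated by the columns of $A$. For finite $\mathcal{F},\mathcal{M}\subset\mathbb{Z}^d$, $\mathcal{F}(\mathcal{M})$ is the graph on $\mathcal{F}$ where $u,v$ are adjacent iff $u-v\in\mathcal{M}$ or $v-u\in\mathcal{M}$; $\operatorname{dist}_{\mathcal{F}(\mathcal{M})}(u,v)$ is the graph distance ($\infty$ if disconnected). $\mathcal{M}$ is a Markov basis of a collection $\mathcal{P}$ of finite subsets of $\mathbb{Z}^d$ if $\mathcal{F}(\mathcal{M})$ is connected for all $\mathcal{F}\in\mathcal{P}$. Fix a norm $\|\cdot\|$ on $\mathbb{R}^d$ (the property below does not depend on the choice). $\mathcal{M}$ is norm-like for $\mathcal{P}$ if there exists a constant $C\in\mathbb{N}$ such that for all $\mathcal{F}\in\mathcal{P}$ and all $u,v\in\mathcal{F}$, $\operatorname{dist}_{\mathcal{F}(\mathcal{M})}(u,v)\le C\|u-v\|$. -}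

module Defs where

open import Data.Nat using (ℕ; suc; _≤_; _*_) renaming (_+_ to _+ℕ_)
open import Data.Integer as ℤ using (ℤ; +_)
open import Data.Vec using (Vec; map; zipWith; foldr; replicate)
open import Data.List using (List)
open import Data.List.Membership.Propositional using (_∈_)
open import Data.List.Relation.Unary.All using (All)
open import Data.Product using (Σ; ∃; _×_; _,_)
open import Data.Sum using (_⊎_)
open import Relation.Binary.PropositionalEquality using (_≡_)

Matrix : ℕ → ℕ → Set
Matrix m d = Vec (Vec ℤ d) m

toℤ : ∀ {d} → Vec ℕ d → Vec ℤ d
toℤ = map (λ n → + n)

dot : ∀ {d} → Vec ℤ d → Vec ℤ d → ℤ
dot x y = foldr _ ℤ._+_ (+ 0) (zipWith ℤ._*_ x y)

_·_ : ∀ {m d} → Matrix m d → Vec ℤ d → Vec ℤ m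
A · x = map (λ row → dot row x) A

_−_ : ∀ {d} → Vec ℤ d → Vec ℤ d → Vec ℤ d
x − y = zipWith ℤ._-_ x y

InKer : ∀ {m d} → Matrix m d → Vec ℤ d → Set
InKer {m} A x = A · x ≡ replicate m (+ 0)

KerPositiveTrivial : ∀ {m d} → Matrix m d → Set
KerPositiveTrivial {m} {d} A =
  ∀ (u : Vec ℕ d) → InKer A (toℤ u) → u ≡ replicate d 0

Fiber : ∀ {m d} → Matrix m d → Vec ℤ m → Vec ℕ d → Set
Fiber A b u = A · toℤ u ≡ b

InSemigroup : ∀ {m d} → Matrix m d → Vec ℤ m → Set
InSemigroup {m} {d} A b = ∃ λ (w : Vec ℕ d) → A · toℤ w ≡ b

Adjacent : ∀ {d} → List (Vec ℤ d) → Vec ℕ d → Vec ℕ d → Set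
Adjacent M u v = ((toℤ u − toℤ v) ∈ M) ⊎ ((toℤ v − toℤ u) ∈ M)

data Walk {d} (F : Vec ℕ d → Set) (M : List (Vec ℤ d)) :
          Vec ℕ d → Vec ℕ d → ℕ → Set where
  here : ∀ {u} → F u → Walk F M u u 0
  step : ∀ {u w v n} → F u → Adjacent M u w → Walk F M w v n →
         Walk F M u v (suc n)

DistLe : ∀ {d} → (Vec ℕ d → Set) → List (Vec ℤ d) → Vec ℕ d → Vec ℕ d → ℕ → Set
DistLe F M u v k = ∃ λ n → Walk F M u v n × n ≤ k

MarkovBasis : ∀ {m d} → Matrix m d → List (Vec ℤ d) → Set
MarkovBasis {m} {d} A M =
  ∀ (b : Vec ℤ m) → InSemigroup A b →
  ∀ (u v : Vec ℕ d) → Fiber A b u → Fiber A b v →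
  ∃ λ n → Walk (Fiber A b) M u v n

-- the 1-norm on ℤ^d (the norm-like property is independent of the norm)
norm₁ : ∀ {d} → Vec ℤ d → ℕ
norm₁ x = foldr _ _+ℕ_ 0 (map ℤ.∣_∣ x)

NormLike : ∀ {m d} → Matrix m d → List (Vec ℤ d) → Set
NormLike {m} {d} A M =
  ∃ λ (C : ℕ) →
  ∀ (b : Vec ℤ m) → InSemigroup A b →
  ∀ (u v : Vec ℕ d) → Fiber A b u → Fiber A b v →
  DistLe (Fiber A b) M u v (C * norm₁ (toℤ u − toℤ v))

module Submission where

-- Write u − v = w⁺ − w⁻ with w⁺ = u ∸ v and w⁻ = v ∸ u, and let B = [A | −A], so that B (w⁺, w⁻) = 0.
-- A Steinitz-type argument (reorder terms so that all prefix sums stay bounded, then apply the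
-- pigeonhole principle to the prefix sums, one row of B at a time) shows that every nonzero
-- w ∈ ℕⁿ with B w = 0 dominates a nonzero y ≤ w with B y = 0 and |y|₁ ≤ K, where K depends only
-- on B. For y = (p, q) this is a move u ↦ u − p + q inside the fibre of u, with p and q in a
-- fixed finite box, that decreases |u − v|₁ by |p|₁ + |q|₁ ≥ 1. As M is a Markov basis, every
-- pair (p, q) with A p = A q is joined by a walk in its own fibre, and translating by u − p
-- turns it into a walk from u to u − p + q. With C the longest of these finitely many walks,
-- induction on |u − v|₁ gives dist(u, v) ≤ C |u − v|₁.

open import Defs

open import Algebra.Structures using (IsCommutativeMonoid)
open import Data.Fin as Fin using (Fin; zero; suc; toℕ; fromℕ<)
import Data.Fin.Properties as FinP
open import Data.Integer as ℤ using (ℤ; +_; -[1+_]; 0ℤ; -_; _+_; _-_; _≤_; _<_; _≤?_)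
import Data.Integer.Properties as ℤP
open import Data.Integer.Tactic.RingSolver using (solve-∀)
open import Data.List as List using (List; []; _∷_; _++_; [_]; length; take; drop; concatMap)
import Data.List.Properties as ListP
open import Data.List.Membership.Propositional using (_∈_; find)
open import Data.List.Membership.Propositional.Properties using (∈-∃++)
open import Data.List.Relation.Binary.Permutation.Propositional
  using (_↭_; refl; prep; swap; trans; ↭-sym; module PermutationReasoning)
import Data.List.Relation.Binary.Permutation.Propositional.Properties as ↭P
open import Data.List.Relation.Unary.All as All using (All; []; _∷_)
open import Data.List.Relation.Unary.All.Properties using (¬Any⇒All¬)
import Data.List.Relation.Unary.Any as Any
open import Data.Nat as ℕ using (ℕ; zero; suc; z≤n; s≤s; _⊔_)
import Data.Nat.Properties as ℕP
open import Data.Nat.Tactic.RingSolver using () renaming (solve-∀ to solveℕ-∀)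
open import Data.Product using (Σ; ∃; ∃₂; _×_; _,_; proj₁; proj₂)
open import Data.Sum using (inj₁; inj₂)
open import Data.Vec as Vec using (Vec; []; _∷_)
import Data.Vec.Properties as VecP
open import Data.Vec.Relation.Binary.Pointwise.Inductive as Pointwise using (Pointwise; []; _∷_)
open import Data.Vec.Relation.Unary.All as VecAll using ([]; _∷_)
import Data.Vec.Relation.Unary.All.Properties as VecAllP
open import Function using (_∘_)
open import Relation.Binary.PropositionalEquality
  using (_≡_; refl; sym; cong; cong₂; subst; subst₂; isEquivalence; module ≡-Reasoning)
  renaming (trans to ≡-trans)
open import Relation.Nullary using (yes; no; contradiction)

open import Algebra.Properties.AbelianGroup ℤP.+-0-abelianGroup using (identityʳ-unique)
open import Algebra.Properties.CommutativeSemigroup ℕP.+-commutativeSemigroup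
  using () renaming (interchange to +-interchange)

module ListSum {C : Set} {_∙_ : C → C → C} {ε : C}
               (isCM : IsCommutativeMonoid _≡_ _∙_ ε) where
  open IsCommutativeMonoid isCM using (assoc; comm; identityˡ)
  open ≡-Reasoning

  sumBy : {I : Set} → (I → C) → List I → C
  sumBy f = List.foldr (λ x s → f x ∙ s) ε

  module _ {I : Set} (f : I → C) where

    sumBy-++ : ∀ xs ys → sumBy f (xs ++ ys) ≡ sumBy f xs ∙ sumBy f ys
    sumBy-++ []       ys = sym (identityˡ _)
    sumBy-++ (x ∷ xs) ys = begin
      f x ∙ sumBy f (xs ++ ys)             ≡⟨ cong (f x ∙_) (sumBy-++ xs ys) ⟩
      f x ∙ (sumBy f xs ∙ sumBy f ys)      ≡⟨ sym (assoc _ _ _) ⟩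
      (f x ∙ sumBy f xs) ∙ sumBy f ys      ∎

    sumBy-↭ : ∀ {xs ys} → xs ↭ ys → sumBy f xs ≡ sumBy f ys
    sumBy-↭ refl          = refl
    sumBy-↭ (prep x p)    = cong (f x ∙_) (sumBy-↭ p)
    sumBy-↭ (swap x y p)  = begin
      f x ∙ (f y ∙ _)   ≡⟨ sym (assoc _ _ _) ⟩
      (f x ∙ f y) ∙ _   ≡⟨ cong₂ _∙_ (comm _ _) (sumBy-↭ p) ⟩
      (f y ∙ f x) ∙ _   ≡⟨ assoc _ _ _ ⟩
      f y ∙ (f x ∙ _)   ∎
    sumBy-↭ (trans p q)   = ≡-trans (sumBy-↭ p) (sumBy-↭ q)

  sumBy-ε : {I : Set} (f : I → C) → (∀ x → f x ≡ ε) → ∀ xs → sumBy f xs ≡ ε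
  sumBy-ε f f≡ε []       = refl
  sumBy-ε f f≡ε (x ∷ xs) = ≡-trans (cong₂ _∙_ (f≡ε x) (sumBy-ε f f≡ε xs)) (identityˡ ε)

  sumBy-concatMap : {I J : Set} (f : I → C) (g : J → List I) (xs : List J) →
                    sumBy f (concatMap g xs) ≡ sumBy (sumBy f ∘ g) xs
  sumBy-concatMap f g []       = refl
  sumBy-concatMap f g (x ∷ xs) = ≡-trans (sumBy-++ f (g x) (concatMap g xs))
                                        (cong (sumBy f (g x) ∙_) (sumBy-concatMap f g xs))

open ListSum ℤP.+-0-isCommutativeMonoid

module _ {I : Set} (f : I → ℤ) where

  sumBy-nonpos : ∀ xs → All (λ x → f x ≤ 0ℤ) xs → sumBy f xs ≤ 0ℤ
  sumBy-nonpos []       []         = ℤP.≤-refl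
  sumBy-nonpos (x ∷ xs) (fx≤0 ∷ h) = ℤP.+-mono-≤ fx≤0 (sumBy-nonpos xs h)

  sumBy-nonneg : ∀ xs → All (λ x → 0ℤ ≤ f x) xs → 0ℤ ≤ sumBy f xs
  sumBy-nonneg []       []         = ℤP.≤-refl
  sumBy-nonneg (x ∷ xs) (0≤fx ∷ h) = ℤP.+-mono-≤ 0≤fx (sumBy-nonneg xs h)

  sumBy-neg : ∀ x xs → All (λ y → f y < 0ℤ) (x ∷ xs) → sumBy f (x ∷ xs) < 0ℤ
  sumBy-neg x xs (fx<0 ∷ h) = ℤP.+-mono-<-≤ fx<0 (sumBy-nonpos xs (All.map ℤP.<⇒≤ h))

  sumBy-pos : ∀ x xs → All (λ y → 0ℤ < f y) (x ∷ xs) → 0ℤ < sumBy f (x ∷ xs)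
  sumBy-pos x xs (0<fx ∷ h) = ℤP.+-mono-<-≤ 0<fx (sumBy-nonneg xs (All.map ℤP.<⇒≤ h))

  ∣sumBy∣≤ : ∀ {Δ} → (∀ x → ℤ.∣ f x ∣ ℕ.≤ Δ) → ∀ xs → ℤ.∣ sumBy f xs ∣ ℕ.≤ length xs ℕ.* Δ
  ∣sumBy∣≤ bounded []       = z≤n
  ∣sumBy∣≤ bounded (x ∷ xs) =
    ℕP.≤-trans (ℤP.∣i+j∣≤∣i∣+∣j∣ (f x) _) (ℕP.+-mono-≤ (bounded x) (∣sumBy∣≤ bounded xs))

∈⇒↭∷ : {I : Set} {x : I} {xs : List I} → x ∈ xs → ∃ λ ys → xs ↭ x ∷ ys
∈⇒↭∷ {x = x} x∈xs with as , bs , refl ← ∈-∃++ x∈xs = as ++ bs , ↭P.shift x as bs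

take-++-drop-take : {I : Set} {i j : ℕ} → i ℕ.≤ j → (ws : List I) →
                    take i ws ++ drop i (take j ws) ≡ take j ws
take-++-drop-take {i = i} {j} i≤j ws = begin
  take i ws ++ drop i (take j ws)          ≡⟨ cong (_++ drop i (take j ws)) take-i-take-j ⟨
  take i (take j ws) ++ drop i (take j ws) ≡⟨ ListP.take++drop≡id i (take j ws) ⟩
  take j ws                                ∎
  where
  open ≡-Reasoning
  take-i-take-j : take i (take j ws) ≡ take i ws
  take-i-take-j = ≡-trans (ListP.take-take i j ws) (cong (λ k → take k ws) (ℕP.m≤n⇒m⊓n≡m i≤j))

concatMap⁺-↭ : {I J : Set} (h : J → List I) {Bs Cs : List J} → Bs ↭ Cs → concatMap h Bs ↭ concatMap h Cs
concatMap⁺-↭ h refl         = refl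
concatMap⁺-↭ h (prep B p)   = ↭P.++⁺ˡ (h B) (concatMap⁺-↭ h p)
concatMap⁺-↭ h (swap B C p) =
  trans (↭P.shifts (h B) (h C)) (↭P.++⁺ˡ (h C) (↭P.++⁺ˡ (h B) (concatMap⁺-↭ h p)))
concatMap⁺-↭ h (trans p q)  = trans (concatMap⁺-↭ h p) (concatMap⁺-↭ h q)

length-concatMap≤ : {I J : Set} (h : J → List I) {L : ℕ} → (∀ B → length (h B) ℕ.≤ L) →
                    ∀ Bs → length (concatMap h Bs) ℕ.≤ length Bs ℕ.* L
length-concatMap≤ h short []       = z≤n
length-concatMap≤ h short (B ∷ Bs) = ℕP.≤-trans (ℕP.≤-reflexive (ListP.length-++ (h B)))
                                       (ℕP.+-mono-≤ (short B) (length-concatMap≤ h short Bs))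

length-rest< : {I : Set} {xs ys zs : List I} → xs ↭ ys ++ zs → 0 ℕ.< length ys → length zs ℕ.< length xs
length-rest< {ys = ys} {zs} split nonempty =
  subst (length zs ℕ.<_) (≡-trans (sym (ListP.length-++ ys)) (sym (↭P.↭-length split)))
        (ℕP.m<n+m (length zs) nonempty)

module _ {I : Set} where

  record Chunk (P : List I → Set) (K : ℕ) : Set where
    field
      items    : List I
      nonempty : 0 ℕ.< length items
      short    : length items ℕ.≤ K
      property : P items

  SmallPart : (List I → Set) → ℕ → List I → Set
  SmallPart P K xs = Σ (Chunk P K) λ c → ∃ λ rest → xs ↭ Chunk.items c ++ rest

  infixChunk : ∀ {P : List I → Set} {K i j} ws → i ℕ.< j → j ℕ.≤ length ws → j ℕ.≤ K →
               P (drop i (take j ws)) → SmallPart P K ws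
  infixChunk {P} {K} {i} {j} ws i<j j≤∣ws∣ j≤K p = chunk , take i ws ++ drop j ws , split
    where
    mid = drop i (take j ws)
    ∣mid∣≡j∸i : length mid ≡ j ℕ.∸ i
    ∣mid∣≡j∸i = ≡-trans (ListP.length-drop i (take j ws))
                  (cong (ℕ._∸ i) (≡-trans (ListP.length-take j ws) (ℕP.m≤n⇒m⊓n≡m j≤∣ws∣)))
    chunk : Chunk P K
    chunk = record
      { items    = mid
      ; nonempty = subst (0 ℕ.<_) (sym ∣mid∣≡j∸i) (ℕP.m<n⇒0<n∸m i<j)
      ; short    = subst (ℕ._≤ K) (sym ∣mid∣≡j∸i) (ℕP.≤-trans (ℕP.m∸n≤m j i) j≤K)
      ; property = p }
    split : ws ↭ mid ++ take i ws ++ drop j ws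
    split = begin
      ws                                  ≡⟨ ListP.take++drop≡id j ws ⟨
      take j ws ++ drop j ws              ≡⟨ cong (_++ drop j ws) (take-++-drop-take (ℕP.<⇒≤ i<j) ws) ⟨
      (take i ws ++ mid) ++ drop j ws     ≡⟨ ListP.++-assoc (take i ws) mid (drop j ws) ⟩
      take i ws ++ mid ++ drop j ws       ↭⟨ ↭P.shifts (take i ws) mid ⟩
      mid ++ take i ws ++ drop j ws       ∎
      where open PermutationReasoning

concatMap-nonempty : {I J : Set} (h : J → List I) → (∀ B → 0 ℕ.< length (h B)) →
                     ∀ Bs → 0 ℕ.< length Bs → 0 ℕ.< length (concatMap h Bs)
concatMap-nonempty h nonempty (B ∷ Bs) _ = ℕP.<-≤-trans (nonempty B) (ListP.length-++-≤ˡ (h B))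

concatMap-nonempty⁻ : {I J : Set} (h : J → List I) {xs : List I} → 0 ℕ.< length xs →
                      ∀ Bs → xs ↭ concatMap h Bs → 0 ℕ.< length Bs
concatMap-nonempty⁻ h nonempty []       xs↭[] = contradiction (↭P.↭-length xs↭[]) (ℕP.>⇒≢ nonempty)
concatMap-nonempty⁻ h nonempty (B ∷ Bs) _     = s≤s z≤n

flattenPart : {I J : Set} {P : List I → Set} {Q : List J → Set} {K L : ℕ} (h : J → List I) →
              (∀ B → 0 ℕ.< length (h B)) → (∀ B → length (h B) ℕ.≤ L) →
              (∀ Ys → Q Ys → P (concatMap h Ys)) →
              ∀ {xs Bs} → xs ↭ concatMap h Bs → SmallPart Q K Bs → SmallPart P (K ℕ.* L) xs
flattenPart h nonempty short Q⇒P {xs} {Bs} xs↭Bs (chunk , rest , Bs↭) =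
  record
    { items    = concatMap h Ys
    ; nonempty = concatMap-nonempty h nonempty Ys (Chunk.nonempty chunk)
    ; short    = ℕP.≤-trans (length-concatMap≤ h short Ys) (ℕP.*-monoˡ-≤ _ (Chunk.short chunk))
    ; property = Q⇒P Ys (Chunk.property chunk) }
  , concatMap h rest , split
  where
  Ys = Chunk.items chunk
  split : xs ↭ concatMap h Ys ++ concatMap h rest
  split = begin
    xs                                ↭⟨ xs↭Bs ⟩
    concatMap h Bs                    ↭⟨ concatMap⁺-↭ h Bs↭ ⟩
    concatMap h (Ys ++ rest)          ≡⟨ ListP.concatMap-++ h Ys rest ⟩
    concatMap h Ys ++ concatMap h rest ∎
    where open PermutationReasoning

-- A Steinitz-type lemma for bounded integer functionals

i≤0≤j⇒∣i+j∣≤n : ∀ {i j n} → i ≤ 0ℤ → 0ℤ ≤ j → ℤ.∣ i ∣ ℕ.≤ n → ℤ.∣ j ∣ ℕ.≤ n → ℤ.∣ i + j ∣ ℕ.≤ n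
i≤0≤j⇒∣i+j∣≤n {+ 0}      {+ b} _ _ _   ∣j∣≤n = ∣j∣≤n
i≤0≤j⇒∣i+j∣≤n {+ suc a}  (ℤ.+≤+ ())
i≤0≤j⇒∣i+j∣≤n { -[1+ a ]} {+ b} _ _ ∣i∣≤n ∣j∣≤n =
  ℕP.≤-trans (ℤP.∣m⊝n∣≤m⊔n b (suc a)) (ℕP.⊔-lub ∣j∣≤n ∣i∣≤n)

rangeSize : ℕ → ℕ
rangeSize Δ = suc (Δ ℕ.+ Δ)

signedCode : ℕ → ℤ → ℕ
signedCode Δ (+ a)    = a
signedCode Δ -[1+ k ] = Δ ℕ.+ suc k

signedCode< : ∀ {Δ} t → ℤ.∣ t ∣ ℕ.≤ Δ → signedCode Δ t ℕ.< rangeSize Δ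
signedCode< {Δ} (+ a)    a≤Δ = s≤s (ℕP.≤-trans a≤Δ (ℕP.m≤m+n Δ Δ))
signedCode< {Δ} -[1+ k ] k<Δ = s≤s (ℕP.+-monoʳ-≤ Δ k<Δ)

signedCode-injective : ∀ {Δ} s t → ℤ.∣ s ∣ ℕ.≤ Δ → ℤ.∣ t ∣ ℕ.≤ Δ →
                       signedCode Δ s ≡ signedCode Δ t → s ≡ t
signedCode-injective     (+ a)    (+ b)    _   _   eq = cong +_ eq
signedCode-injective {Δ} -[1+ k ] -[1+ l ] _   _   eq =
  cong -[1+_] (ℕP.suc-injective (ℕP.+-cancelˡ-≡ Δ _ _ eq))
signedCode-injective {Δ} (+ a)    -[1+ l ] a≤Δ _   eq =
  contradiction (subst (ℕ._≤ Δ) eq a≤Δ) (ℕP.m+1+n≰m Δ)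
signedCode-injective {Δ} -[1+ k ] (+ b)    _   b≤Δ eq =
  contradiction (subst (ℕ._≤ Δ) (sym eq) b≤Δ) (ℕP.m+1+n≰m Δ)

module Balancing {I : Set} (f : I → ℤ) {Δ : ℕ} (bounded : ∀ x → ℤ.∣ f x ∣ ℕ.≤ Δ) where

  BalancedFrom : ℤ → List I → Set
  BalancedFrom s ws = ∀ k → ℤ.∣ s + sumBy f (take k ws) ∣ ℕ.≤ Δ

  -- The remaining terms sum to −s, so one of them has the sign opposite to s (or is 0),
  -- and adding it keeps the running sum in [−Δ, Δ].
  balancingTerm : ∀ s x xs → ℤ.∣ s ∣ ℕ.≤ Δ → s + sumBy f (x ∷ xs) ≡ 0ℤ →
                  ∃ λ y → y ∈ x ∷ xs × ℤ.∣ s + f y ∣ ℕ.≤ Δ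
  balancingTerm s x xs ∣s∣≤Δ s+Σ≡0 with s ≤? 0ℤ
  ... | yes s≤0 with Any.any? (λ y → 0ℤ ≤? f y) (x ∷ xs)
  ...   | yes some = let y , y∈ , 0≤fy = find some in
                     y , y∈ , i≤0≤j⇒∣i+j∣≤n s≤0 0≤fy ∣s∣≤Δ (bounded y)
  ...   | no none  = contradiction s+Σ≡0 (ℤP.<⇒≢ (ℤP.+-mono-≤-< s≤0
                       (sumBy-neg f x xs (All.map ℤP.≰⇒> (¬Any⇒All¬ (x ∷ xs) none)))))
  balancingTerm s x xs ∣s∣≤Δ s+Σ≡0 | no s≰0 with Any.any? (λ y → f y ≤? 0ℤ) (x ∷ xs)
  ...   | yes some = let y , y∈ , fy≤0 = find some in
                     y , y∈ , subst (λ t → ℤ.∣ t ∣ ℕ.≤ Δ) (ℤP.+-comm (f y) s)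
                                (i≤0≤j⇒∣i+j∣≤n fy≤0 (ℤP.<⇒≤ (ℤP.≰⇒> s≰0)) (bounded y) ∣s∣≤Δ)
  ...   | no none  = contradiction (sym s+Σ≡0) (ℤP.<⇒≢ (ℤP.+-mono-<-≤ (ℤP.≰⇒> s≰0)
                       (ℤP.<⇒≤ (sumBy-pos f x xs (All.map ℤP.≰⇒> (¬Any⇒All¬ (x ∷ xs) none))))))

  bounded-+0 : ∀ s → ℤ.∣ s ∣ ℕ.≤ Δ → ℤ.∣ s + 0ℤ ∣ ℕ.≤ Δ
  bounded-+0 s = subst (λ t → ℤ.∣ t ∣ ℕ.≤ Δ) (sym (ℤP.+-identityʳ s))

  balanced-[] : ∀ s → ℤ.∣ s ∣ ℕ.≤ Δ → BalancedFrom s []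
  balanced-[] s ∣s∣≤Δ zero    = bounded-+0 s ∣s∣≤Δ
  balanced-[] s ∣s∣≤Δ (suc k) = bounded-+0 s ∣s∣≤Δ

  balanced-∷ : ∀ s y {ws} → ℤ.∣ s ∣ ℕ.≤ Δ → BalancedFrom (s + f y) ws → BalancedFrom s (y ∷ ws)
  balanced-∷ s y ∣s∣≤Δ _        zero    = bounded-+0 s ∣s∣≤Δ
  balanced-∷ s y _     balanced (suc k) =
    subst (λ t → ℤ.∣ t ∣ ℕ.≤ Δ) (ℤP.+-assoc s (f y) _) (balanced k)

  balancedReordering : ∀ n xs → length xs ≡ n → ∀ s → ℤ.∣ s ∣ ℕ.≤ Δ → s + sumBy f xs ≡ 0ℤ →
                       ∃ λ ws → xs ↭ ws × BalancedFrom s ws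
  balancedReordering _       []       _      s ∣s∣≤Δ _ = [] , refl , balanced-[] s ∣s∣≤Δ
  balancedReordering (suc n) (x ∷ xs) ∣xs∣≡n s ∣s∣≤Δ s+Σ≡0 =
    let y , y∈ , ∣s+fy∣≤Δ      = balancingTerm s x xs ∣s∣≤Δ s+Σ≡0
        xs′ , x∷xs↭y∷xs′       = ∈⇒↭∷ y∈
        ∣xs′∣≡n                = ℕP.suc-injective (≡-trans (sym (↭P.↭-length x∷xs↭y∷xs′)) ∣xs∣≡n)
        s+fy+Σ≡0               = ≡-trans (ℤP.+-assoc s (f y) _)
                                   (≡-trans (cong (λ t → s + t) (sumBy-↭ f (↭-sym x∷xs↭y∷xs′))) s+Σ≡0)
        ws , xs′↭ws , balanced = balancedReordering n xs′ ∣xs′∣≡n (s + f y) ∣s+fy∣≤Δ s+fy+Σ≡0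
    in  y ∷ ws , trans x∷xs↭y∷xs′ (prep y xs′↭ws) , balanced-∷ s y ∣s∣≤Δ balanced

  ZeroSum : List I → Set
  ZeroSum ys = sumBy f ys ≡ 0ℤ

  -- Two of the first rangeSize Δ + 1 prefix sums coincide, and the segment between them sums to zero.
  windowChunk : ∀ ws → BalancedFrom 0ℤ ws → rangeSize Δ ℕ.< length ws →
                SmallPart ZeroSum (rangeSize Δ) ws
  windowChunk ws balanced long = fromCollision (FinP.pigeonhole (ℕP.n<1+n (rangeSize Δ)) prefixCode)
    where
    prefix : ℕ → ℤ
    prefix k = sumBy f (take k ws)
    ∣prefix∣≤Δ : ∀ k → ℤ.∣ prefix k ∣ ℕ.≤ Δ
    ∣prefix∣≤Δ k = subst (λ t → ℤ.∣ t ∣ ℕ.≤ Δ) (ℤP.+-identityˡ (prefix k)) (balanced k)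
    prefixCode : Fin (suc (rangeSize Δ)) → Fin (rangeSize Δ)
    prefixCode k = fromℕ< (signedCode< (prefix (toℕ k)) (∣prefix∣≤Δ (toℕ k)))
    fromCollision : ∃₂ (λ i j → i Fin.< j × prefixCode i ≡ prefixCode j) →
                    SmallPart ZeroSum (rangeSize Δ) ws
    fromCollision (i , j , i<j , same-code) =
      infixChunk ws i<j (ℕP.≤-trans j≤range (ℕP.<⇒≤ long)) j≤range mid-zero
      where
      mid = drop (toℕ i) (take (toℕ j) ws)
      j≤range : toℕ j ℕ.≤ rangeSize Δ
      j≤range = ℕP.≤-pred (FinP.toℕ<n j)
      same-prefix : prefix (toℕ i) ≡ prefix (toℕ j)
      same-prefix = signedCode-injective _ _ (∣prefix∣≤Δ (toℕ i)) (∣prefix∣≤Δ (toℕ j))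
        (≡-trans (sym (FinP.toℕ-fromℕ< _)) (≡-trans (cong toℕ same-code) (FinP.toℕ-fromℕ< _)))
      mid-zero : ZeroSum mid
      mid-zero = identityʳ-unique (prefix (toℕ i)) _ (begin
        prefix (toℕ i) + sumBy f mid       ≡⟨ sumBy-++ f (take (toℕ i) ws) mid ⟨
        sumBy f (take (toℕ i) ws ++ mid)   ≡⟨ cong (sumBy f) (take-++-drop-take (ℕP.<⇒≤ i<j) ws) ⟩
        prefix (toℕ j)                     ≡⟨ same-prefix ⟨
        prefix (toℕ i)                     ∎)
        where open ≡-Reasoning

  zeroSumChunk : ∀ xs → 0 ℕ.< length xs → ZeroSum xs → SmallPart ZeroSum (rangeSize Δ) xs
  zeroSumChunk xs nonempty Σ≡0 with length xs ℕ.≤? rangeSize Δ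
  ... | yes short = record { items = xs ; nonempty = nonempty ; short = short ; property = Σ≡0 }
                  , [] , ↭-sym (↭P.++-identityʳ xs)
  ... | no long   =
    let ws , xs↭ws , balanced = balancedReordering (length xs) xs refl 0ℤ z≤n
                                  (≡-trans (ℤP.+-identityˡ _) Σ≡0)
        chunk , rest , ws↭    = windowChunk ws balanced
                                  (subst (rangeSize Δ ℕ.<_) (↭P.↭-length xs↭ws) (ℕP.≰⇒> long))
    in  chunk , rest , trans xs↭ws ws↭

  zeroSum-rest : ∀ {xs ys zs} → xs ↭ ys ++ zs → ZeroSum ys → ZeroSum xs → ZeroSum zs
  zeroSum-rest {xs} {ys} {zs} split Σys≡0 Σxs≡0 = begin
    sumBy f zs                   ≡⟨ ℤP.+-identityˡ _ ⟨
    0ℤ + sumBy f zs              ≡⟨ cong (λ t → t + sumBy f zs) Σys≡0 ⟨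
    sumBy f ys + sumBy f zs      ≡⟨ sumBy-++ f ys zs ⟨
    sumBy f (ys ++ zs)           ≡⟨ sumBy-↭ f split ⟨
    sumBy f xs                   ≡⟨ Σxs≡0 ⟩
    0ℤ                           ∎
    where open ≡-Reasoning

  blockDecomposition : ∀ n xs → length xs ℕ.≤ n → ZeroSum xs →
                       ∃ λ (Bs : List (Chunk ZeroSum (rangeSize Δ))) → xs ↭ concatMap Chunk.items Bs
  blockDecomposition _       []       _       _    = [] , refl
  blockDecomposition (suc n) (x ∷ xs) ∣xs∣≤n Σ≡0 = splitOff (zeroSumChunk (x ∷ xs) (s≤s z≤n) Σ≡0)
    where
    splitOff : SmallPart ZeroSum (rangeSize Δ) (x ∷ xs) →
               ∃ λ (Bs : List (Chunk ZeroSum (rangeSize Δ))) → x ∷ xs ↭ concatMap Chunk.items Bs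
    splitOff (chunk , rest , split) =
      let Bs , rest↭Bs = blockDecomposition n rest
                           (ℕP.≤-pred (ℕP.≤-trans (length-rest< {ys = items} split nonempty) ∣xs∣≤n))
                           (zeroSum-rest {ys = items} {rest} split property Σ≡0)
      in  chunk ∷ Bs , trans split (↭P.++⁺ˡ items rest↭Bs)
      where open Chunk chunk

ZeroSums : {I : Set} {m : ℕ} → Vec (I → ℤ) m → List I → Set
ZeroSums gs ys = VecAll.All (λ g → sumBy g ys ≡ 0ℤ) gs

-- Zero-sum blocks for the first functional have at most rangeSize Δ elements, so on
-- blocks the remaining functionals are bounded by rangeSize Δ * Δ.
steinitzBound : ℕ → ℕ → ℕ
steinitzBound zero    Δ = 1
steinitzBound (suc m) Δ = steinitzBound m (rangeSize Δ ℕ.* Δ) ℕ.* rangeSize Δ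

smallZeroSumPart : ∀ {m} {I : Set} (gs : Vec (I → ℤ) m) {Δ} →
                   VecAll.All (λ g → ∀ x → ℤ.∣ g x ∣ ℕ.≤ Δ) gs →
                   ∀ xs → 0 ℕ.< length xs → ZeroSums gs xs →
                   SmallPart (ZeroSums gs) (steinitzBound m Δ) xs
smallZeroSumPart []       _ (x ∷ xs) _ [] =
  record { items = [ x ] ; nonempty = s≤s z≤n ; short = s≤s z≤n ; property = [] } , xs , refl
smallZeroSumPart {I = I} (f ∷ gs) {Δ} (f-bounded ∷ gs-bounded) xs nonempty (Σf≡0 ∷ Σgs≡0) =
  flattenPart items Chunk.nonempty Chunk.short zeroSums-flatten {Bs = Bs} xs↭Bs
    (smallZeroSumPart (Vec.map blockSum gs) blockSums-bounded Bs
      (concatMap-nonempty⁻ items nonempty Bs xs↭Bs) blockSums-zero)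
  where
  open Balancing f f-bounded using (ZeroSum; blockDecomposition)
  open Chunk using (items)
  Block = Chunk ZeroSum (rangeSize Δ)
  blockSum : (I → ℤ) → Block → ℤ
  blockSum g B = sumBy g (items B)
  decomposition = blockDecomposition (length xs) xs ℕP.≤-refl Σf≡0
  Bs = proj₁ decomposition
  xs↭Bs = proj₂ decomposition
  sumBy-flatten : ∀ g Ys → sumBy g (concatMap items Ys) ≡ sumBy (blockSum g) Ys
  sumBy-flatten g Ys = sumBy-concatMap g items Ys
  blockSums-bounded : VecAll.All (λ g → ∀ B → ℤ.∣ g B ∣ ℕ.≤ rangeSize Δ ℕ.* Δ) (Vec.map blockSum gs)
  blockSums-bounded = VecAllP.map⁺ (VecAll.map (λ {g} g-bounded B →
    ℕP.≤-trans (∣sumBy∣≤ g g-bounded (items B)) (ℕP.*-monoˡ-≤ Δ (Chunk.short B))) gs-bounded)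
  blockSums-zero : ZeroSums (Vec.map blockSum gs) Bs
  blockSums-zero = VecAllP.map⁺ (VecAll.map (λ {g} Σg≡0 →
    ≡-trans (sym (sumBy-flatten g Bs)) (≡-trans (sym (sumBy-↭ g xs↭Bs)) Σg≡0)) Σgs≡0)
  zeroSums-flatten : ∀ Ys → ZeroSums (Vec.map blockSum gs) Ys → ZeroSums (f ∷ gs) (concatMap items Ys)
  zeroSums-flatten Ys Σ≡0 =
    ≡-trans (sumBy-flatten f Ys) (sumBy-ε (blockSum f) Chunk.property Ys)
    ∷ VecAll.map (λ {g} Σg≡0 → ≡-trans (sumBy-flatten g Ys) Σg≡0) (VecAllP.map⁻ Σ≡0)

infixl 6 _⊕_ _∸ᵥ_
infix  4 _≤ᵥ_

_⊕_ : ∀ {n} → Vec ℕ n → Vec ℕ n → Vec ℕ n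
_⊕_ = Vec.zipWith ℕ._+_

_∸ᵥ_ : ∀ {n} → Vec ℕ n → Vec ℕ n → Vec ℕ n
_∸ᵥ_ = Vec.zipWith ℕ._∸_

_≤ᵥ_ : ∀ {n} → Vec ℕ n → Vec ℕ n → Set
_≤ᵥ_ = Pointwise ℕ._≤_

zeros : ∀ n → Vec ℕ n
zeros n = Vec.replicate n 0

⊕-isCommutativeMonoid : ∀ n → IsCommutativeMonoid _≡_ (_⊕_ {n}) (zeros n)
⊕-isCommutativeMonoid n = record
  { isMonoid = record
    { isSemigroup = record
      { isMagma = record { isEquivalence = isEquivalence ; ∙-cong = cong₂ _⊕_ }
      ; assoc   = VecP.zipWith-assoc ℕP.+-assoc }
    ; identity  = VecP.zipWith-identityˡ ℕP.+-identityˡ , VecP.zipWith-identityʳ ℕP.+-identityʳ }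
  ; comm = VecP.zipWith-comm ℕP.+-comm }

x≤ᵥx⊕y : ∀ {n} (x y : Vec ℕ n) → x ≤ᵥ x ⊕ y
x≤ᵥx⊕y []      []      = []
x≤ᵥx⊕y (a ∷ x) (b ∷ y) = ℕP.m≤m+n a b ∷ x≤ᵥx⊕y x y

x⊕[y∸ᵥx]≡y : ∀ {n} {x y : Vec ℕ n} → x ≤ᵥ y → x ⊕ (y ∸ᵥ x) ≡ y
x⊕[y∸ᵥx]≡y []          = refl
x⊕[y∸ᵥx]≡y (a≤b ∷ x≤y) = cong₂ _∷_ (ℕP.m+[n∸m]≡n a≤b) (x⊕[y∸ᵥx]≡y x≤y)

x∸ᵥy≤ᵥx : ∀ {n} (x y : Vec ℕ n) → x ∸ᵥ y ≤ᵥ x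
x∸ᵥy≤ᵥx []      []      = []
x∸ᵥy≤ᵥx (a ∷ x) (b ∷ y) = ℕP.m∸n≤m a b ∷ x∸ᵥy≤ᵥx x y

sum-⊕ : ∀ {n} (x y : Vec ℕ n) → Vec.sum (x ⊕ y) ≡ Vec.sum x ℕ.+ Vec.sum y
sum-⊕ []      []      = refl
sum-⊕ (a ∷ x) (b ∷ y) = ≡-trans (cong (a ℕ.+ b ℕ.+_) (sum-⊕ x y)) (+-interchange a b _ _)

entries≤sum : ∀ {n} (x : Vec ℕ n) → VecAll.All (ℕ._≤ Vec.sum x) x
entries≤sum []      = []
entries≤sum (a ∷ x) = ℕP.m≤m+n a _ ∷ VecAll.map (λ b≤ → ℕP.≤-trans b≤ (ℕP.m≤n+m _ a)) (entries≤sum x)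

toℤ-⊕ : ∀ {n} (x y : Vec ℕ n) → toℤ (x ⊕ y) ≡ Vec.zipWith _+_ (toℤ x) (toℤ y)
toℤ-⊕ []      []      = refl
toℤ-⊕ (a ∷ x) (b ∷ y) = cong₂ _∷_ (ℤP.pos-+ a b) (toℤ-⊕ x y)

dot-zipWith-+ : ∀ {n} (a x y : Vec ℤ n) → dot a (Vec.zipWith _+_ x y) ≡ dot a x + dot a y
dot-zipWith-+ []      []      []      = refl
dot-zipWith-+ (c ∷ a) (s ∷ x) (t ∷ y) =
  ≡-trans (cong (λ r → c ℤ.* (s + t) + r) (dot-zipWith-+ a x y)) (distrib c s t _ _)
  where
  distrib : ∀ c s t u v → c ℤ.* (s + t) + (u + v) ≡ (c ℤ.* s + u) + (c ℤ.* t + v)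
  distrib = solve-∀

dot-− : ∀ {n} (a x y : Vec ℤ n) → dot a (x − y) ≡ dot a x - dot a y
dot-− []      []      []      = refl
dot-− (c ∷ a) (s ∷ x) (t ∷ y) =
  ≡-trans (cong (λ r → c ℤ.* (s - t) + r) (dot-− a x y)) (distrib c s t _ _)
  where
  distrib : ∀ c s t u v → c ℤ.* (s - t) + (u - v) ≡ (c ℤ.* s + u) - (c ℤ.* t + v)
  distrib = solve-∀

dot-zeros : ∀ {n} (a : Vec ℤ n) → dot a (Vec.replicate n 0ℤ) ≡ 0ℤ
dot-zeros []      = refl
dot-zeros (c ∷ a) = ≡-trans (cong (λ r → c ℤ.* 0ℤ + r) (dot-zeros a)) (annihilate c)
  where
  annihilate : ∀ c → c ℤ.* 0ℤ + 0ℤ ≡ 0ℤ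
  annihilate = solve-∀

·-toℤ-⊕ : ∀ {m n} (A : Matrix m n) (x y : Vec ℕ n) →
          A · toℤ (x ⊕ y) ≡ Vec.zipWith _+_ (A · toℤ x) (A · toℤ y)
·-toℤ-⊕ []      x y = refl
·-toℤ-⊕ (a ∷ A) x y =
  cong₂ _∷_ (≡-trans (cong (dot a) (toℤ-⊕ x y)) (dot-zipWith-+ a (toℤ x) (toℤ y))) (·-toℤ-⊕ A x y)

·-− : ∀ {m n} (A : Matrix m n) (x y : Vec ℤ n) → A · (x − y) ≡ (A · x) − (A · y)
·-− []      x y = refl
·-− (a ∷ A) x y = cong₂ _∷_ (dot-− a x y) (·-− A x y)

x−x≡0 : ∀ {n} (x : Vec ℤ n) → x − x ≡ Vec.replicate n 0ℤ
x−x≡0 []      = refl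
x−x≡0 (s ∷ x) = cong₂ _∷_ (ℤP.+-inverseʳ s) (x−x≡0 x)

x−y≡0⇒x≡y : ∀ {n} (x y : Vec ℤ n) → x − y ≡ Vec.replicate n 0ℤ → x ≡ y
x−y≡0⇒x≡y []      []      _  = refl
x−y≡0⇒x≡y (s ∷ x) (t ∷ y) eq =
  cong₂ _∷_ (ℤP.i-j≡0⇒i≡j s t (VecP.∷-injectiveˡ eq)) (x−y≡0⇒x≡y x y (VecP.∷-injectiveʳ eq))

InKer⇒All : ∀ {m n} (B : Matrix m n) {x} → InKer B x → VecAll.All (λ b → dot b x ≡ 0ℤ) B
InKer⇒All []      _  = []
InKer⇒All (b ∷ B) eq = VecP.∷-injectiveˡ eq ∷ InKer⇒All B (VecP.∷-injectiveʳ eq)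

All⇒InKer : ∀ {m n} {B : Matrix m n} {x} → VecAll.All (λ b → dot b x ≡ 0ℤ) B → InKer B x
All⇒InKer []         = refl
All⇒InKer (eq ∷ eqs) = cong₂ _∷_ eq (All⇒InKer eqs)

-- Small nonnegative kernel vectors

toℤ-zeros : ∀ n → toℤ (zeros n) ≡ Vec.replicate n 0ℤ
toℤ-zeros n = VecP.map-replicate +_ 0 n

sum-zeros : ∀ n → Vec.sum (zeros n) ≡ 0
sum-zeros zero    = refl
sum-zeros (suc n) = sum-zeros n

unit : ∀ {n} → Fin n → Vec ℕ n
unit {suc n} zero    = 1 ∷ zeros n
unit         (suc j) = 0 ∷ unit j

sum-unit : ∀ {n} (j : Fin n) → Vec.sum (unit j) ≡ 1
sum-unit {suc n} zero    = cong suc (sum-zeros n)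
sum-unit         (suc j) = sum-unit j

dot-unit : ∀ {n} (a : Vec ℤ n) j → dot a (toℤ (unit j)) ≡ Vec.lookup a j
dot-unit {suc n} (c ∷ a) zero    = begin
  c ℤ.* + 1 + dot a (toℤ (zeros n))       ≡⟨ cong (λ r → c ℤ.* + 1 + dot a r) (toℤ-zeros n) ⟩
  c ℤ.* + 1 + dot a (Vec.replicate n 0ℤ)  ≡⟨ cong (λ r → c ℤ.* + 1 + r) (dot-zeros a) ⟩
  c ℤ.* + 1 + 0ℤ                          ≡⟨ unitᵣ c ⟩
  c                                       ∎
  where
  open ≡-Reasoning
  unitᵣ : ∀ c → c ℤ.* + 1 + 0ℤ ≡ c
  unitᵣ = solve-∀
dot-unit (c ∷ a) (suc j) =
  ≡-trans (cong₂ _+_ (ℤP.*-zeroʳ c) (dot-unit a j)) (ℤP.+-identityˡ _)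

module ⊕-Sum {n : ℕ} = ListSum (⊕-isCommutativeMonoid n)

tally : ∀ {n} → List (Fin n) → Vec ℕ n
tally = ⊕-Sum.sumBy unit

sum-tally : ∀ {n} (js : List (Fin n)) → Vec.sum (tally js) ≡ length js
sum-tally {n} []       = sum-zeros n
sum-tally     (j ∷ js) = ≡-trans (sum-⊕ (unit j) (tally js)) (cong₂ ℕ._+_ (sum-unit j) (sum-tally js))

dot-tally : ∀ {n} (a : Vec ℤ n) js → dot a (toℤ (tally js)) ≡ sumBy (Vec.lookup a) js
dot-tally {n} a []       = ≡-trans (cong (dot a) (toℤ-zeros n)) (dot-zeros a)
dot-tally     a (j ∷ js) = begin
  dot a (toℤ (unit j ⊕ tally js))                         ≡⟨ cong (dot a) (toℤ-⊕ (unit j) (tally js)) ⟩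
  dot a (Vec.zipWith _+_ (toℤ (unit j)) (toℤ (tally js))) ≡⟨ dot-zipWith-+ a _ _ ⟩
  dot a (toℤ (unit j)) + dot a (toℤ (tally js))           ≡⟨ cong₂ _+_ (dot-unit a j) (dot-tally a js) ⟩
  Vec.lookup a j + sumBy (Vec.lookup a) js                ∎
  where open ≡-Reasoning

expand : ∀ {n} → Vec ℕ n → List (Fin n)
expand []      = []
expand (k ∷ w) = List.replicate k zero ++ List.map suc (expand w)

tally-replicate-zero : ∀ {n} k → tally (List.replicate k (zero {n})) ≡ k ∷ zeros n
tally-replicate-zero {n} zero    = refl
tally-replicate-zero {n} (suc k) =
  ≡-trans (cong (λ t → unit zero ⊕ t) (tally-replicate-zero k))
          (cong (suc k ∷_) (VecP.zipWith-identityˡ ℕP.+-identityˡ (zeros n)))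

tally-map-suc : ∀ {n} (js : List (Fin n)) → tally (List.map suc js) ≡ 0 ∷ tally js
tally-map-suc []       = refl
tally-map-suc (j ∷ js) = cong (λ t → unit (suc j) ⊕ t) (tally-map-suc js)

tally-expand : ∀ {n} (w : Vec ℕ n) → tally (expand w) ≡ w
tally-expand []      = refl
tally-expand {suc n} (k ∷ w) = begin
  tally (copies ++ shifted)              ≡⟨ ⊕-Sum.sumBy-++ unit copies shifted ⟩
  tally copies ⊕ tally shifted           ≡⟨ cong₂ _⊕_ (tally-replicate-zero k) (tally-map-suc (expand w)) ⟩
  (k ∷ zeros n) ⊕ (0 ∷ tally (expand w)) ≡⟨ cong₂ _∷_ (ℕP.+-identityʳ k)
                                                      (VecP.zipWith-identityˡ ℕP.+-identityˡ _) ⟩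
  k ∷ tally (expand w)                   ≡⟨ cong (k ∷_) (tally-expand w) ⟩
  k ∷ w                                  ∎
  where
  open ≡-Reasoning
  copies  = List.replicate k zero
  shifted = List.map suc (expand w)

module _ {m n} (B : Matrix m n) where

  zeroSums⇒InKer : ∀ js → ZeroSums (Vec.map Vec.lookup B) js → InKer B (toℤ (tally js))
  zeroSums⇒InKer js Σ≡0 =
    All⇒InKer (VecAll.map (λ {b} Σb≡0 → ≡-trans (dot-tally b js) Σb≡0) (VecAllP.map⁻ Σ≡0))

  InKer⇒zeroSums : ∀ js → InKer B (toℤ (tally js)) → ZeroSums (Vec.map Vec.lookup B) js
  InKer⇒zeroSums js ker =
    VecAllP.map⁺ (VecAll.map (λ {b} dot≡0 → ≡-trans (sym (dot-tally b js)) dot≡0) (InKer⇒All B ker))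

  record KernelPart (K : ℕ) (w : Vec ℕ n) : Set where
    field
      part rest : Vec ℕ n
      split     : part ⊕ rest ≡ w
      nonzero   : 0 ℕ.< Vec.sum part
      small     : Vec.sum part ℕ.≤ K
      kernel    : InKer B (toℤ part)

  -- Coordinate j of w is an item repeated w[j] times; the rows of B are the functionals.
  smallKernelPart : ∀ {Δ} → VecAll.All (λ b → ∀ j → ℤ.∣ Vec.lookup b j ∣ ℕ.≤ Δ) B →
                    ∀ w → 0 ℕ.< Vec.sum w → InKer B (toℤ w) → KernelPart (steinitzBound m Δ) w
  smallKernelPart bounded w nonzero ker =
    fromSmallPart (smallZeroSumPart (Vec.map Vec.lookup B) (VecAllP.map⁺ bounded) (expand w)
                     (subst (0 ℕ.<_) (sym ∣expand∣≡sum) nonzero)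
                     (InKer⇒zeroSums (expand w) (subst (InKer B ∘ toℤ) (sym (tally-expand w)) ker)))
    where
    ∣expand∣≡sum : length (expand w) ≡ Vec.sum w
    ∣expand∣≡sum = ≡-trans (sym (sum-tally (expand w))) (cong Vec.sum (tally-expand w))
    fromSmallPart : SmallPart (ZeroSums (Vec.map Vec.lookup B)) (steinitzBound m _) (expand w) →
                    KernelPart (steinitzBound m _) w
    fromSmallPart (chunk , rest , split) = record
      { part    = tally items
      ; rest    = tally rest
      ; split   = begin
          tally items ⊕ tally rest  ≡⟨ ⊕-Sum.sumBy-++ unit items rest ⟨
          tally (items ++ rest)     ≡⟨ ⊕-Sum.sumBy-↭ unit split ⟨
          tally (expand w)          ≡⟨ tally-expand w ⟩
          w                         ∎
      ; nonzero = subst (0 ℕ.<_) (sym (sum-tally items)) nonempty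
      ; small   = subst (ℕ._≤ _) (sym (sum-tally items)) short
      ; kernel  = zeroSums⇒InKer items property }
      where
      open Chunk chunk
      open ≡-Reasoning

-- ℓ¹-distances and moves inside a fibre

∣+m-+n∣≡∣m-n∣ : ∀ m n → ℤ.∣ + m - + n ∣ ≡ ℕ.∣ m - n ∣
∣+m-+n∣≡∣m-n∣ m n with ℕP.≤-total m n
... | inj₁ m≤n = ≡-trans (cong ℤ.∣_∣ (ℤP.m-n≡m⊖n m n))
                   (≡-trans (ℤP.∣⊖∣-≤ m≤n) (sym (ℕP.m≤n⇒∣m-n∣≡n∸m m≤n)))
... | inj₂ n≤m = ≡-trans (cong ℤ.∣_∣ (≡-trans (ℤP.m-n≡m⊖n m n) (ℤP.⊖-≥ n≤m)))
                   (sym (ℕP.m≤n⇒∣n-m∣≡n∸m n≤m))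

distance-step : ∀ a b p q → p ℕ.≤ a ℕ.∸ b → q ℕ.≤ b ℕ.∸ a →
                ℕ.∣ q ℕ.+ (a ℕ.∸ p) - b ∣ ℕ.+ (p ℕ.+ q) ≡ ℕ.∣ a - b ∣
distance-step a b p q p≤a∸b q≤b∸a with ℕP.≤-total a b
... | inj₁ a≤b rewrite ℕP.n≤0⇒n≡0 (subst (p ℕ.≤_) (ℕP.m≤n⇒m∸n≡0 a≤b) p≤a∸b) = begin
  ℕ.∣ q ℕ.+ a - b ∣ ℕ.+ q                  ≡⟨ cong (λ t → ℕ.∣ q ℕ.+ a - t ∣ ℕ.+ q) b≡q+a+k ⟩
  ℕ.∣ q ℕ.+ a - q ℕ.+ a ℕ.+ k ∣ ℕ.+ q      ≡⟨ cong (ℕ._+ q) (ℕP.∣m-m+n∣≡n (q ℕ.+ a) k) ⟩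
  k ℕ.+ q                                  ≡⟨ ℕP.m∸n+n≡m q≤b∸a ⟩
  b ℕ.∸ a                                  ≡⟨ ℕP.m≤n⇒∣m-n∣≡n∸m a≤b ⟨
  ℕ.∣ a - b ∣                              ∎
  where
  open ≡-Reasoning
  k = b ℕ.∸ a ℕ.∸ q
  b≡q+a+k : b ≡ q ℕ.+ a ℕ.+ k
  b≡q+a+k = begin
    b                      ≡⟨ ℕP.m+[n∸m]≡n a≤b ⟨
    a ℕ.+ (b ℕ.∸ a)        ≡⟨ cong (a ℕ.+_) (ℕP.m∸n+n≡m q≤b∸a) ⟨
    a ℕ.+ (k ℕ.+ q)        ≡⟨ rearrange a k q ⟩
    q ℕ.+ a ℕ.+ k          ∎
    where
    rearrange : ∀ a k q → a ℕ.+ (k ℕ.+ q) ≡ q ℕ.+ a ℕ.+ k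
    rearrange = solveℕ-∀
... | inj₂ b≤a rewrite ℕP.n≤0⇒n≡0 (subst (q ℕ.≤_) (ℕP.m≤n⇒m∸n≡0 b≤a) q≤b∸a) = begin
  ℕ.∣ a ℕ.∸ p - b ∣ ℕ.+ (p ℕ.+ 0)          ≡⟨ cong₂ (λ s t → ℕ.∣ s - b ∣ ℕ.+ t) a∸p≡b+k (ℕP.+-identityʳ p) ⟩
  ℕ.∣ b ℕ.+ k - b ∣ ℕ.+ p                  ≡⟨ cong (ℕ._+ p) (ℕP.∣-∣-comm (b ℕ.+ k) b) ⟩
  ℕ.∣ b - b ℕ.+ k ∣ ℕ.+ p                  ≡⟨ cong (ℕ._+ p) (ℕP.∣m-m+n∣≡n b k) ⟩
  k ℕ.+ p                                  ≡⟨ ℕP.m∸n+n≡m p≤a∸b ⟩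
  a ℕ.∸ b                                  ≡⟨ ℕP.m≤n⇒∣n-m∣≡n∸m b≤a ⟨
  ℕ.∣ a - b ∣                              ∎
  where
  open ≡-Reasoning
  k = a ℕ.∸ b ℕ.∸ p
  a∸p≡b+k : a ℕ.∸ p ≡ b ℕ.+ k
  a∸p≡b+k = begin
    a ℕ.∸ p                  ≡⟨ cong (ℕ._∸ p) (ℕP.m+[n∸m]≡n b≤a) ⟨
    b ℕ.+ (a ℕ.∸ b) ℕ.∸ p    ≡⟨ ℕP.+-∸-assoc b p≤a∸b ⟩
    b ℕ.+ k                  ∎

∣m-n∣≡m∸n+n∸m : ∀ m n → ℕ.∣ m - n ∣ ≡ m ℕ.∸ n ℕ.+ (n ℕ.∸ m)
∣m-n∣≡m∸n+n∸m m n with ℕP.≤-total m n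
... | inj₁ m≤n rewrite ℕP.m≤n⇒m∸n≡0 m≤n = ℕP.m≤n⇒∣m-n∣≡n∸m m≤n
... | inj₂ n≤m rewrite ℕP.m≤n⇒m∸n≡0 n≤m = ≡-trans (ℕP.m≤n⇒∣n-m∣≡n∸m n≤m) (sym (ℕP.+-identityʳ _))

norm₁-toℤ-− : ∀ {d} (u v : Vec ℕ d) → norm₁ (toℤ u − toℤ v) ≡ Vec.sum (u ∸ᵥ v) ℕ.+ Vec.sum (v ∸ᵥ u)
norm₁-toℤ-− []      []      = refl
norm₁-toℤ-− (a ∷ u) (b ∷ v) =
  ≡-trans (cong₂ ℕ._+_ (≡-trans (∣+m-+n∣≡∣m-n∣ a b) (∣m-n∣≡m∸n+n∸m a b)) (norm₁-toℤ-− u v))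
          (+-interchange (a ℕ.∸ b) (b ℕ.∸ a) _ _)

norm₁-step : ∀ {d} (u v p q : Vec ℕ d) → p ≤ᵥ u ∸ᵥ v → q ≤ᵥ v ∸ᵥ u →
             norm₁ (toℤ (q ⊕ (u ∸ᵥ p)) − toℤ v) ℕ.+ (Vec.sum p ℕ.+ Vec.sum q) ≡ norm₁ (toℤ u − toℤ v)
norm₁-step []      []      []      []      []           []           = refl
norm₁-step (a ∷ u) (b ∷ v) (c ∷ p) (e ∷ q) (c≤ ∷ p≤) (e≤ ∷ q≤) = begin
  ∣a′-b∣ ℕ.+ ∥u′−v∥ ℕ.+ (c ℕ.+ P ℕ.+ (e ℕ.+ Q))    ≡⟨ cong (∣a′-b∣ ℕ.+ ∥u′−v∥ ℕ.+_) (+-interchange c P e Q) ⟩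
  ∣a′-b∣ ℕ.+ ∥u′−v∥ ℕ.+ (c ℕ.+ e ℕ.+ (P ℕ.+ Q))    ≡⟨ +-interchange ∣a′-b∣ ∥u′−v∥ (c ℕ.+ e) (P ℕ.+ Q) ⟩
  ∣a′-b∣ ℕ.+ (c ℕ.+ e) ℕ.+ (∥u′−v∥ ℕ.+ (P ℕ.+ Q))  ≡⟨ cong₂ ℕ._+_ coordinate (norm₁-step u v p q p≤ q≤) ⟩
  ℤ.∣ + a - + b ∣ ℕ.+ norm₁ (toℤ u − toℤ v)        ∎
  where
  open ≡-Reasoning
  P = Vec.sum p
  Q = Vec.sum q
  a′ = e ℕ.+ (a ℕ.∸ c)
  ∣a′-b∣ = ℤ.∣ + a′ - + b ∣
  ∥u′−v∥ = norm₁ (toℤ (q ⊕ (u ∸ᵥ p)) − toℤ v)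
  coordinate : ∣a′-b∣ ℕ.+ (c ℕ.+ e) ≡ ℤ.∣ + a - + b ∣
  coordinate = begin
    ∣a′-b∣ ℕ.+ (c ℕ.+ e)           ≡⟨ cong (ℕ._+ (c ℕ.+ e)) (∣+m-+n∣≡∣m-n∣ a′ b) ⟩
    ℕ.∣ a′ - b ∣ ℕ.+ (c ℕ.+ e)     ≡⟨ distance-step a b c e c≤ e≤ ⟩
    ℕ.∣ a - b ∣                    ≡⟨ ∣+m-+n∣≡∣m-n∣ a b ⟨
    ℤ.∣ + a - + b ∣                ∎

norm₁-zero : ∀ {d} (u v : Vec ℕ d) → norm₁ (toℤ u − toℤ v) ≡ 0 → u ≡ v
norm₁-zero []      []      _  = refl
norm₁-zero (a ∷ u) (b ∷ v) eq =
  cong₂ _∷_ (ℕP.∣m-n∣≡0⇒m≡n (≡-trans (sym (∣+m-+n∣≡∣m-n∣ a b)) (ℕP.m+n≡0⇒m≡0 _ eq)))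
            (norm₁-zero u v (ℕP.m+n≡0⇒n≡0 _ eq))

toℤ-∸ᵥ : ∀ {d} (u v : Vec ℕ d) → toℤ (u ∸ᵥ v) − toℤ (v ∸ᵥ u) ≡ toℤ u − toℤ v
toℤ-∸ᵥ []      []      = refl
toℤ-∸ᵥ (a ∷ u) (b ∷ v) = cong₂ _∷_ (scalar a b) (toℤ-∸ᵥ u v)
  where
  scalar : ∀ a b → + (a ℕ.∸ b) - + (b ℕ.∸ a) ≡ + a - + b
  scalar a b with ℕP.≤-total a b
  ... | inj₁ a≤b rewrite ℕP.m≤n⇒m∸n≡0 a≤b =
    ≡-trans (ℤP.+-identityˡ _) (sym (≡-trans (ℤP.m-n≡m⊖n a b) (ℤP.⊖-≤ a≤b)))
  ... | inj₂ b≤a rewrite ℕP.m≤n⇒m∸n≡0 b≤a =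
    ≡-trans (ℤP.+-identityʳ _) (sym (≡-trans (ℤP.m-n≡m⊖n a b) (ℤP.⊖-≥ b≤a)))

module _ {m d} (A : Matrix m d) where

  ·−≡0⇒≡ : ∀ x y → A · (x − y) ≡ Vec.replicate m 0ℤ → A · x ≡ A · y
  ·−≡0⇒≡ x y eq = x−y≡0⇒x≡y (A · x) (A · y) (≡-trans (sym (·-− A x y)) eq)

  ≡⇒·−≡0 : ∀ x y → A · x ≡ A · y → A · (x − y) ≡ Vec.replicate m 0ℤ
  ≡⇒·−≡0 x y eq = ≡-trans (·-− A x y) (≡-trans (cong (λ z → z − (A · y)) eq) (x−x≡0 (A · y)))

  withNegation : Matrix m (d ℕ.+ d)
  withNegation = Vec.map (λ a → a Vec.++ Vec.map -_ a) A

  withNegation-· : ∀ x y → withNegation · (x Vec.++ y) ≡ A · (x − y)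
  withNegation-· x y = go A
    where
    dot-++ : ∀ {k l} (a x : Vec ℤ k) (a′ x′ : Vec ℤ l) →
             dot (a Vec.++ a′) (x Vec.++ x′) ≡ dot a x + dot a′ x′
    dot-++ []      []      a′ x′ = sym (ℤP.+-identityˡ _)
    dot-++ (c ∷ a) (s ∷ x) a′ x′ =
      ≡-trans (cong (λ t → c ℤ.* s + t) (dot-++ a x a′ x′)) (sym (ℤP.+-assoc (c ℤ.* s) _ _))
    dot-neg : ∀ {k} (a x : Vec ℤ k) → dot (Vec.map -_ a) x ≡ - dot a x
    dot-neg []      []      = refl
    dot-neg (c ∷ a) (s ∷ x) = ≡-trans (cong (λ t → - c ℤ.* s + t) (dot-neg a x)) (negate c s _)
      where
      negate : ∀ c s t → - c ℤ.* s + - t ≡ - (c ℤ.* s + t)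
      negate = solve-∀
    go : ∀ {k} (B : Matrix k d) → Vec.map (λ a → a Vec.++ Vec.map -_ a) B · (x Vec.++ y) ≡ B · (x − y)
    go []      = refl
    go (a ∷ B) = cong₂ _∷_ (≡-trans (dot-++ a x (Vec.map -_ a) y)
                             (≡-trans (cong (λ t → dot a x + t) (dot-neg a y)) (sym (dot-− a x y))))
                           (go B)

∣lookup∣≤norm₁ : ∀ {n} (a : Vec ℤ n) j → ℤ.∣ Vec.lookup a j ∣ ℕ.≤ norm₁ a
∣lookup∣≤norm₁ (c ∷ a) zero    = ℕP.m≤m+n _ _
∣lookup∣≤norm₁ (c ∷ a) (suc j) = ℕP.≤-trans (∣lookup∣≤norm₁ a j) (ℕP.m≤n+m _ _)

entryBound : ∀ {m n} → Matrix m n → ℕ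
entryBound B = Vec.sum (Vec.map norm₁ B)

∣entries∣≤entryBound : ∀ {m n} (B : Matrix m n) →
                       VecAll.All (λ b → ∀ j → ℤ.∣ Vec.lookup b j ∣ ℕ.≤ entryBound B) B
∣entries∣≤entryBound B = VecAll.map (λ {b} ∥b∥≤ j → ℕP.≤-trans (∣lookup∣≤norm₁ b j) ∥b∥≤)
                                     (VecAllP.map⁻ (entries≤sum (Vec.map norm₁ B)))

module Moves {m d} (A : Matrix m d) where

  moveBound : ℕ
  moveBound = steinitzBound m (entryBound (withNegation A))

  record Move (u v : Vec ℕ d) : Set where
    field
      removed added : Vec ℕ d
      sameImage     : A · toℤ removed ≡ A · toℤ added
      removed≤u     : removed ≤ᵥ u
      removed-small : VecAll.All (ℕ._≤ moveBound) removed
      added-small   : VecAll.All (ℕ._≤ moveBound) added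
      progress      : norm₁ (toℤ (added ⊕ (u ∸ᵥ removed)) − toℤ v) ℕ.< norm₁ (toℤ u − toℤ v)

    next : Vec ℕ d
    next = added ⊕ (u ∸ᵥ removed)

  -- A kernel vector p ++ q ≤ (u ∸ v) ++ (v ∸ u) of [A | −A] has p supported where u exceeds v
  -- and q where v exceeds u, so replacing p by q in u brings it closer to v.
  move : ∀ {u v} → A · toℤ u ≡ A · toℤ v → 0 ℕ.< norm₁ (toℤ u − toℤ v) → Move u v
  move {u} {v} Au≡Av 0<∥u−v∥ =
    fromKernelPart
      (smallKernelPart (withNegation A) (∣entries∣≤entryBound (withNegation A)) w 0<∑w w∈ker)
    where
    w = (u ∸ᵥ v) Vec.++ (v ∸ᵥ u)
    0<∑w : 0 ℕ.< Vec.sum w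
    0<∑w = subst (0 ℕ.<_) (≡-trans (norm₁-toℤ-− u v) (sym (VecP.sum-++ (u ∸ᵥ v)))) 0<∥u−v∥
    w∈ker : InKer (withNegation A) (toℤ w)
    w∈ker = begin
      withNegation A · toℤ w
        ≡⟨ cong (withNegation A ·_) (VecP.map-++ +_ (u ∸ᵥ v) _) ⟩
      withNegation A · (toℤ (u ∸ᵥ v) Vec.++ toℤ (v ∸ᵥ u)) ≡⟨ withNegation-· A _ _ ⟩
      A · (toℤ (u ∸ᵥ v) − toℤ (v ∸ᵥ u))                   ≡⟨ cong (A ·_) (toℤ-∸ᵥ u v) ⟩
      A · (toℤ u − toℤ v)                                 ≡⟨ ≡⇒·−≡0 A _ _ Au≡Av ⟩
      Vec.replicate m 0ℤ                                  ∎
      where open ≡-Reasoning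
    fromKernelPart : KernelPart (withNegation A) moveBound w → Move u v
    fromKernelPart record { part = part ; rest = rest ; split = split ; nonzero = nonzero
                          ; small = small ; kernel = kernel }
      with p , q , refl ← Vec.splitAt d part = record
      { removed       = p
      ; added         = q
      ; sameImage     = ·−≡0⇒≡ A (toℤ p) (toℤ q)
                          (≡-trans (sym (withNegation-· A (toℤ p) (toℤ q)))
                            (subst (InKer (withNegation A)) (VecP.map-++ +_ p q) kernel))
      ; removed≤u     = Pointwise.trans ℕP.≤-trans p≤u∸v (x∸ᵥy≤ᵥx u v)
      ; removed-small = proj₁ p,q-small
      ; added-small   = proj₂ p,q-small
      ; progress      = subst (norm₁ (toℤ (q ⊕ (u ∸ᵥ p)) − toℤ v) ℕ.<_)
                          (norm₁-step u v p q p≤u∸v q≤v∸u)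
                          (ℕP.m<m+n _ (subst (0 ℕ.<_) (VecP.sum-++ p) nonzero)) }
      where
      p++q≤w : p Vec.++ q ≤ᵥ w
      p++q≤w = subst (p Vec.++ q ≤ᵥ_) split (x≤ᵥx⊕y (p Vec.++ q) rest)
      p≤u∸v : p ≤ᵥ u ∸ᵥ v
      p≤u∸v = Pointwise.++ˡ⁻ p (u ∸ᵥ v) p++q≤w
      q≤v∸u : q ≤ᵥ v ∸ᵥ u
      q≤v∸u = Pointwise.++ʳ⁻ p (u ∸ᵥ v) p++q≤w
      p,q-small : VecAll.All (ℕ._≤ moveBound) p × VecAll.All (ℕ._≤ moveBound) q
      p,q-small = VecAllP.++⁻ p (VecAll.map (λ x≤ → ℕP.≤-trans x≤ small) (entries≤sum (p Vec.++ q)))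

-- Walks of bounded length

Walk-++ : ∀ {d} {F : Vec ℕ d → Set} {M u w v n k} →
          Walk F M u w n → Walk F M w v k → Walk F M u v (n ℕ.+ k)
Walk-++ (here _)        q = q
Walk-++ (step fu adj p) q = step fu adj (Walk-++ p q)

Walk-end : ∀ {d} {F : Vec ℕ d → Set} {M u v n} → Walk F M u v n → F v
Walk-end (here fv)    = fv
Walk-end (step _ _ p) = Walk-end p

toℤ-⊕-− : ∀ {d} (x y t : Vec ℕ d) → toℤ (x ⊕ t) − toℤ (y ⊕ t) ≡ toℤ x − toℤ y
toℤ-⊕-− []      []      []      = refl
toℤ-⊕-− (a ∷ x) (b ∷ y) (c ∷ t) =
  cong₂ _∷_ (≡-trans (cong₂ _-_ (ℤP.pos-+ a c) (ℤP.pos-+ b c)) (cancel (+ a) (+ b) (+ c)))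
            (toℤ-⊕-− x y t)
  where
  cancel : ∀ a b c → (a + c) - (b + c) ≡ a - b
  cancel = solve-∀

Adjacent-⊕ : ∀ {d} (M : List (Vec ℤ d)) {x y} t → Adjacent M x y → Adjacent M (x ⊕ t) (y ⊕ t)
Adjacent-⊕ M {x} {y} t (inj₁ x−y∈M) = inj₁ (subst (_∈ M) (sym (toℤ-⊕-− x y t)) x−y∈M)
Adjacent-⊕ M {x} {y} t (inj₂ y−x∈M) = inj₂ (subst (_∈ M) (sym (toℤ-⊕-− y x t)) y−x∈M)

translateWalk : ∀ {d} {F G : Vec ℕ d → Set} {M x y n} t → (∀ {z} → F z → G (z ⊕ t)) →
                Walk F M x y n → Walk G M (x ⊕ t) (y ⊕ t) n
translateWalk t F⇒G (here fx)       = here (F⇒G fx)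
translateWalk t F⇒G (step fx adj p) = step (F⇒G fx) (Adjacent-⊕ _ t adj) (translateWalk t F⇒G p)

Fiber-⊕ : ∀ {m d} (A : Matrix m d) {z p} t → Fiber A (A · toℤ p) z → Fiber A (A · toℤ (p ⊕ t)) (z ⊕ t)
Fiber-⊕ A {z} {p} t Az≡Ap = begin
  A · toℤ (z ⊕ t)                             ≡⟨ ·-toℤ-⊕ A z t ⟩
  Vec.zipWith _+_ (A · toℤ z) (A · toℤ t)     ≡⟨ cong (λ c → Vec.zipWith _+_ c (A · toℤ t)) Az≡Ap ⟩
  Vec.zipWith _+_ (A · toℤ p) (A · toℤ t)     ≡⟨ ·-toℤ-⊕ A p t ⟨
  A · toℤ (p ⊕ t)                             ∎
  where open ≡-Reasoning

maxUpTo : ℕ → (ℕ → ℕ) → ℕ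
maxUpTo zero    g = g 0
maxUpTo (suc K) g = maxUpTo K g ⊔ g (suc K)

≤-maxUpTo : ∀ g {k K} → k ℕ.≤ K → g k ℕ.≤ maxUpTo K g
≤-maxUpTo g {K = zero}  z≤n = ℕP.≤-refl
≤-maxUpTo g {K = suc K} k≤1+K with ℕP.m≤n⇒m<n∨m≡n k≤1+K
... | inj₁ k<1+K = ℕP.≤-trans (≤-maxUpTo g (ℕP.≤-pred k<1+K)) (ℕP.m≤m⊔n _ _)
... | inj₂ refl  = ℕP.m≤n⊔m _ _

maxOverBox : ∀ d → ℕ → (Vec ℕ d → ℕ) → ℕ
maxOverBox zero    K g = g []
maxOverBox (suc d) K g = maxUpTo K (λ k → maxOverBox d K (g ∘ (k ∷_)))

≤-maxOverBox : ∀ {d} K g {p : Vec ℕ d} → VecAll.All (ℕ._≤ K) p → g p ℕ.≤ maxOverBox d K g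
≤-maxOverBox K g []                   = ℕP.≤-refl
≤-maxOverBox K g {k ∷ p} (k≤K ∷ p≤K) =
  ℕP.≤-trans (≤-maxOverBox K (g ∘ (k ∷_)) p≤K) (≤-maxUpTo (λ k → maxOverBox _ K (g ∘ (k ∷_))) k≤K)

module WalkBound {m d} (A : Matrix m d) (M : List (Vec ℤ d)) (markov : MarkovBasis A M) where
  open Moves A

  -- A function of (p, q) alone, so that it can be maximised over a box; 0 is a junk value
  -- for pairs with different images.
  walkLength : Vec ℕ d → Vec ℕ d → ℕ
  walkLength p q with VecP.≡-dec ℤ._≟_ (A · toℤ p) (A · toℤ q)
  ... | yes Ap≡Aq = proj₁ (markov (A · toℤ p) (p , refl) p q refl (sym Ap≡Aq))
  ... | no _      = 0

  walkFor : ∀ p q → A · toℤ p ≡ A · toℤ q → Walk (Fiber A (A · toℤ p)) M p q (walkLength p q)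
  walkFor p q Ap≡Aq with VecP.≡-dec ℤ._≟_ (A · toℤ p) (A · toℤ q)
  ... | yes Ap≡Aq′ = proj₂ (markov (A · toℤ p) (p , refl) p q refl (sym Ap≡Aq′))
  ... | no Ap≢Aq   = contradiction Ap≡Aq Ap≢Aq

  C : ℕ
  C = maxOverBox d moveBound (λ p → maxOverBox d moveBound (walkLength p))

  walkLength≤C : ∀ {p q} → VecAll.All (ℕ._≤ moveBound) p → VecAll.All (ℕ._≤ moveBound) q →
                 walkLength p q ℕ.≤ C
  walkLength≤C {p} p-small q-small =
    ℕP.≤-trans (≤-maxOverBox moveBound (walkLength p) q-small)
               (≤-maxOverBox moveBound (λ p → maxOverBox d moveBound (walkLength p)) p-small)

  moveWalk : ∀ {b u v} → Fiber A b u → (mv : Move u v) →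
             Walk (Fiber A b) M u (Move.next mv) (walkLength (Move.removed mv) (Move.added mv))
  moveWalk {b} {u} fu mv =
    subst₂ (λ c x → Walk (Fiber A c) M x next _) (≡-trans (cong (λ x → A · toℤ x) p⊕w≡u) fu) p⊕w≡u
      (translateWalk (u ∸ᵥ removed) (Fiber-⊕ A (u ∸ᵥ removed)) (walkFor removed added sameImage))
    where
    open Move mv
    p⊕w≡u : removed ⊕ (u ∸ᵥ removed) ≡ u
    p⊕w≡u = x⊕[y∸ᵥx]≡y removed≤u

  distanceBound : ∀ N {b u v} → Fiber A b u → Fiber A b v → norm₁ (toℤ u − toℤ v) ℕ.≤ N →
                  DistLe (Fiber A b) M u v (C ℕ.* norm₁ (toℤ u − toℤ v))
  distanceBound N {b} {u} {v} fu fv ∥u−v∥≤N with norm₁ (toℤ u − toℤ v) in ∥u−v∥≡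
  ... | zero = 0 , subst (λ x → Walk (Fiber A b) M u x 0) (norm₁-zero u v ∥u−v∥≡) (here fu) , z≤n
  distanceBound (suc N) {b} {u} {v} fu fv (s≤s n≤N) | suc n =
    continue (move (≡-trans fu (sym fv)) (subst (0 ℕ.<_) (sym ∥u−v∥≡) (s≤s z≤n)))
    where
    continue : Move u v → DistLe (Fiber A b) M u v (C ℕ.* suc n)
    continue mv =
      let k , rest , k≤C∥next−v∥ = distanceBound N (Walk-end first) fv (ℕP.≤-trans ∥next−v∥≤n n≤N)
      in  walkLength removed added ℕ.+ k , Walk-++ first rest ,
          ℕP.≤-trans (ℕP.+-mono-≤ (walkLength≤C removed-small added-small)
                                  (ℕP.≤-trans k≤C∥next−v∥ (ℕP.*-monoʳ-≤ C ∥next−v∥≤n)))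
                     (ℕP.≤-reflexive (sym (ℕP.*-suc C n)))
      where
      open Move mv
      first : Walk (Fiber A b) M u next (walkLength removed added)
      first = moveWalk fu mv
      ∥next−v∥≤n : norm₁ (toℤ next − toℤ v) ℕ.≤ n
      ∥next−v∥≤n = ℕP.≤-pred (subst (norm₁ (toℤ next − toℤ v) ℕ.<_) ∥u−v∥≡ progress)

proposition3p7 : ∀ (m d : ℕ) (A : Matrix m d) (M : List (Vec ℤ d)) →
    KerPositiveTrivial A →
    All (InKer A) M →
    MarkovBasis A M →
    NormLike A M
proposition3p7 m d A M _ _ markov = C , λ b _ u v fu fv → distanceBound _ fu fv ℕP.≤-refl
  where open WalkBound A M markov
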